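{- Fix an integer $d>0$ and let $p=\frac{d}{d+1}$. For each $n\ge d+1$ let $\pi_n$ be chosen uniformly at random from the permutations $\pi\in S_n$ with $\mathrm{Des}(\pi)=d$. Then for every $\epsilon>0$ there is an $N$ such that \[ \left| \frac{\mathbb{P}(\pi_n(1)=k)}{(1-p)p^{k-1}} - 1 \right| < \epsilon \] for all integers $n$ and $k$ with $n\ge N$ and $1\le k\le n$.
   Context: $S_n$ is the set of permutations of $\{1,\dots,n\}$. A descent of $\pi\in S_n$ is an index $i$ with $1\le i\le n-1$ and $\pi(i)>\pi(i+1)$; $\mathrm{Des}(\pi)$ is the number of descents of $\pi$. -}

module Defs where

open import Data.Nat as ℕ using (ℕ; zero; suc; _<ᵇ_)
open import Data.Fin using (Fin; toℕ)
open import Data.Fin.Properties using (_≟_)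
open import Data.List using (List; []; _∷_; map; concatMap; filter; length; allFin)
open import Data.Vec as Vec using (Vec; []; _∷_; toList)
open import Data.Bool using (Bool; true; false; if_then_else_)
open import Data.Product using (_×_)
import Relation.Nullary
open import Relation.Nullary using (yes; no; ¬_)
open import Relation.Nullary.Decidable using (_×-dec_)
open import Relation.Binary.PropositionalEquality using (_≡_)
open import Data.List.Relation.Unary.Unique.Propositional using (Unique)
import Data.List.Relation.Unary.Unique.DecPropositional as UD

unique? : ∀ {n} (xs : List (Fin n)) → Relation.Nullary.Dec (Unique xs)
unique? {n} = UD.unique? (_≟_ {n})
open import Data.Integer using (+_)
open import Data.Rational as ℚ using (ℚ; _/_; _÷_; _*_; _-_; 1ℚ; 0ℚ; ≢-nonZero)
import Data.Rational.Properties as ℚP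

words : (n m : ℕ) → List (Vec (Fin n) m)
words n zero    = [] ∷ []
words n (suc m) = concatMap (λ x → map (x ∷_) (words n m)) (allFin n)

-- A permutation π ∈ S_n in one-line notation (π(1),…,π(n)), with values shifted
-- down by one (value j ∈ {1,…,n} is stored as the element of Fin n with toℕ = j-1):
-- a word of length n over Fin n with no repeated letter.
IsPerm : ∀ {n} → Vec (Fin n) n → Set
IsPerm w = Unique (toList w)

desL : ∀ {n} → List (Fin n) → ℕ
desL []           = 0
desL (x ∷ [])     = 0
desL (x ∷ y ∷ ys) = (if toℕ y <ᵇ toℕ x then 1 else 0) ℕ.+ desL (y ∷ ys)

isPerm? : ∀ {n} (w : Vec (Fin n) n) → Relation.Nullary.Dec (IsPerm w)
isPerm? w = unique? (toList w)

Des : ∀ {n} → Vec (Fin n) n → ℕ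
Des w = desL (toList w)

first : ∀ {n} → Vec (Fin (suc n)) (suc n) → ℕ
first (x ∷ _) = suc (toℕ x)

countDes : (n d : ℕ) → ℕ
countDes n d = length (filter (λ w → isPerm? w ×-dec (Des w ℕ.≟ d)) (words n n))

countDesFirst : (m d k : ℕ) → ℕ
countDesFirst m d k =
  length (filter (λ w → isPerm? w ×-dec ((Des w ℕ.≟ d) ×-dec (first w ℕ.≟ k)))
                 (words (suc m) (suc m)))

_^ℚ_ : ℚ → ℕ → ℚ
q ^ℚ zero  = 1ℚ
q ^ℚ suc k = q * (q ^ℚ k)

-- Division of rationals, total (value 0 when dividing by 0; never used in that case below).
_÷₀_ : ℚ → ℚ → ℚ
p ÷₀ q with q ℚ.≟ 0ℚ
... | yes _  = 0ℚ
... | no q≢0 = _÷_ p q {{≢-nonZero q≢0}}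

ℕtoℚ : ℕ → ℚ
ℕtoℚ a = (+ a) / 1

-- P(π_n(1) = k) for π_n uniform on { π ∈ S_n : Des(π) = d }, n = m+1.
probFirst : (m d k : ℕ) → ℚ
probFirst m d k = ℕtoℚ (countDesFirst m d k) ÷₀ ℕtoℚ (countDes (suc m) d)

pOf : ℕ → ℚ
pOf d = (+ d) / suc d

geom : (d k : ℕ) → ℚ
geom d k = (1ℚ - pOf d) * (pOf d ^ℚ (k ℕ.∸ 1))

{-# OPTIONS --safe #-}
module Submission where

-- Deleting π(1) and standardising, the number E m d x of π ∈ S_{m+1} with d descents and
-- π(1) = x + 1 satisfies E (m+1) d x = Σ_{y<x} E m (d-1) y + Σ_{x≤y≤m} E m d y, because
-- π(1) > π(2) exactly when the standardised second letter is below x + 1.  The leading terms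
-- L m d x = d^x (d+1)^(m-x) obey the same recurrence up to the boundary term L (m+1) (d-1) x,
-- so by induction  L m d x - (m+1) L m (d-1) x ≤ E m d x ≤ L m d x,  and summing over x,
-- (d+1)^(m+1) - (m+2) d^(m+1) ≤ Σ_x E m d x ≤ (d+1)^(m+1).  Since (d-1)(d+1) ≤ d², both
-- relative errors are at most (m+2) (d/(d+1))^m, uniformly in x, while
-- L m d x / (d+1)^(m+1) = d^x / (d+1)^(x+1) = (1-p) p^x.  A second-order Bernoulli bound on
-- (1 + 1/d)^m makes (m+2) (d/(d+1))^m small beyond an explicit threshold.

open import Defs
open import Data.Nat using (ℕ; suc; _≤_; _<_)
open import Data.Product using (Σ)
open import Data.Rational using (ℚ; 0ℚ; 1ℚ; _-_; ∣_∣) renaming (_<_ to _<ℚ_)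

open import Data.Bool using (Bool; true; false; if_then_else_; _∧_)
open import Data.Bool.Properties using (if-float; ∧-zeroʳ; ∧-identityʳ; ∧-assoc)
open import Data.Empty using (⊥-elim)
open import Data.Fin using (Fin; zero; suc; toℕ; punchIn)
open import Data.Fin.Properties using (toℕ<n; punchIn-injective; punchInᵢ≢i)
import Data.Integer as ℤ
import Data.Integer.Properties as ℤ
open import Data.List as List using (List; []; _∷_; length; filter; concatMap; tabulate)
open import Data.List.Properties using (length-++; filter-++)
import Data.List.Relation.Unary.All as All
import Data.List.Relation.Unary.All.Properties as All
open import Data.List.Relation.Unary.AllPairs using (_∷_)
open import Data.List.Relation.Unary.Unique.Propositional using (Unique)
import Data.List.Relation.Unary.Unique.Propositional.Properties as Unique
open import Data.Nat using (zero; _+_; _*_; _∸_; _^_; _<ᵇ_; _≡ᵇ_; z≤n; s≤s; >-nonZero)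
open import Data.Nat.Coprimality using (Coprime; 1-coprimeTo) renaming (sym to coprime-sym)
import Data.Nat.Properties as ℕ
open import Data.Nat.Properties
  using ( ≤-refl; ≤-trans; ≤-reflexive; ≤-pred; <-≤-trans; ≤-<-trans; <⇒≢; n≤1+n; m≤n⇒m≤1+n
        ; m≤m+n; m≤n+m; m+n≤o⇒m≤o; m≤n⇒∃[o]m+o≡n; m≤m*n; m^n>0
        ; +-identityʳ; +-assoc; +-comm; +-suc; +-∸-assoc; n∸n≡0; m∸n+n≡m; m+[n∸m]≡n
        ; *-identityʳ; *-assoc; *-comm; *-distribˡ-+; *-distribʳ-+; ^-distribˡ-+-*
        ; +-mono-≤; +-monoˡ-≤; +-monoʳ-≤; +-monoʳ-<; *-mono-≤; *-monoˡ-≤; *-monoʳ-≤; *-monoˡ-<; *-monoʳ-<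
        ; +-cancelʳ-≡; +-cancelʳ-≤; +-cancelʳ-<; *-cancelˡ-<
        ; module ≤-Reasoning )
open import Data.Nat.Tactic.RingSolver using (solve-∀)
open import Data.Product using (_,_; _×_; proj₁; proj₂)
open import Data.Rational using (mkℚ; toℚᵘ) renaming (_+_ to _+ℚ_; _*_ to _*ℚ_; _≤_ to _≤ℚ_)
import Data.Rational as ℚ
import Data.Rational.Properties as ℚ
open import Data.Rational.Solver using (module +-*-Solver)
open +-*-Solver using (solve; _:+_; _:*_; _:-_; :-_; con; _:=_)
import Data.Rational.Unnormalised as ℚᵘ
import Data.Rational.Unnormalised.Properties as ℚᵘ
open import Data.Sum using (inj₁; inj₂)
open import Data.Vec as Vec using (Vec; []; _∷_; toList)
open import Data.Vec.Membership.Propositional using (_∈_)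
open import Data.Vec.Membership.Propositional.Properties using (∈-toList⁺)
open import Data.Vec.Properties using (toList-map)
open import Data.Vec.Relation.Unary.Any using (here; there)
open import Function using (_∘_; _⇔_; mk⇔)
open import Relation.Binary.PropositionalEquality
open import Relation.Nullary using (does; ¬_; yes; no)
open import Relation.Nullary.Decidable using (dec-false; does-⇔)
open import Relation.Unary using (Pred; Decidable)

open import Algebra.Properties.Semiring.Sum ℕ.+-*-semiring
  using (sum-syntax; sum-remove; sum-cong-≗; sum-replicate-zero; ∑-distrib-+; *-distribˡ-sum)
open import Algebra.Properties.CommutativeSemigroup ℕ.+-commutativeSemigroup using (interchange)

sumBelow : ℕ → (ℕ → ℕ) → ℕ
sumBelow n f = ∑[ i < n ] f (toℕ i)

sumBelow-cong : ∀ n {f g : ℕ → ℕ} → (∀ y → y < n → f y ≡ g y) → sumBelow n f ≡ sumBelow n g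
sumBelow-cong n f≡g = sum-cong-≗ (λ i → f≡g (toℕ i) (toℕ<n i))

sumBelow-mono : ∀ n {f g : ℕ → ℕ} → (∀ y → y < n → f y ≤ g y) → sumBelow n f ≤ sumBelow n g
sumBelow-mono zero    f≤g = z≤n
sumBelow-mono (suc n) f≤g = +-mono-≤ (f≤g 0 (s≤s z≤n)) (sumBelow-mono n (λ y y<n → f≤g (suc y) (s≤s y<n)))

sumBelow-+ : ∀ n (f g : ℕ → ℕ) → sumBelow n (λ y → f y + g y) ≡ sumBelow n f + sumBelow n g
sumBelow-+ n f g = ∑-distrib-+ {n} (f ∘ toℕ) (g ∘ toℕ)

sumBelow-* : ∀ n c (f : ℕ → ℕ) → sumBelow n (λ y → c * f y) ≡ c * sumBelow n f
sumBelow-* n c f = sym (*-distribˡ-sum {n} c (f ∘ toℕ))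

sumBelow-snoc : ∀ n (f : ℕ → ℕ) → sumBelow (suc n) f ≡ sumBelow n f + f n
sumBelow-snoc zero    f = +-comm (f 0) 0
sumBelow-snoc (suc n) f = trans (cong (f 0 +_) (sumBelow-snoc n (f ∘ suc))) (sym (+-assoc (f 0) _ _))

sumBelow-indicator : ∀ n (f : ℕ → ℕ) {x} → x < n → sumBelow n (λ y → if y ≡ᵇ x then f y else 0) ≡ f x
sumBelow-indicator (suc n) f {zero}  _         = trans (cong (f 0 +_) (sum-replicate-zero n)) (+-identityʳ (f 0))
sumBelow-indicator (suc n) f {suc x} (s≤s x<n) = sumBelow-indicator n (f ∘ suc) x<n

piecewise : ℕ → (ℕ → ℕ) → (ℕ → ℕ) → ℕ → ℕ
piecewise x f g y = if y <ᵇ x then f y else g y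

if-mono : ∀ b {p p′ q q′ : ℕ} → p ≤ p′ → q ≤ q′ → (if b then p else q) ≤ (if b then p′ else q′)
if-mono true  p≤p′ _    = p≤p′
if-mono false _    q≤q′ = q≤q′

piecewise-+ : ∀ x y (f f′ g g′ : ℕ → ℕ) →
  piecewise x (λ z → f z + f′ z) (λ z → g z + g′ z) y ≡ piecewise x f g y + piecewise x f′ g′ y
piecewise-+ x y f f′ g g′ with y <ᵇ x
... | true  = refl
... | false = refl

∑-piecewise-* : ∀ n x c (f g : ℕ → ℕ) →
  sumBelow n (piecewise x (λ y → c * f y) (λ y → c * g y)) ≡ c * sumBelow n (piecewise x f g)
∑-piecewise-* n x c f g =
  trans (sumBelow-cong n (λ y _ → sym (if-float (c *_) (y <ᵇ x) {f y} {g y}))) (sumBelow-* n c (piecewise x f g))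

∑-piecewise : ∀ n {x} (f g : ℕ → ℕ) → x ≤ n →
  sumBelow n (piecewise x f g) + sumBelow x g ≡ sumBelow x f + sumBelow n g
∑-piecewise n       {zero}  f g _         = +-identityʳ (sumBelow n g)
∑-piecewise (suc n) {suc x} f g (s≤s x≤n) = begin
  (f 0 + sumBelow n (piecewise x (f ∘ suc) (g ∘ suc))) + (g 0 + sumBelow x (g ∘ suc))
    ≡⟨ interchange (f 0) _ (g 0) _ ⟩
  (f 0 + g 0) + (sumBelow n (piecewise x (f ∘ suc) (g ∘ suc)) + sumBelow x (g ∘ suc))
    ≡⟨ cong (f 0 + g 0 +_) (∑-piecewise n (f ∘ suc) (g ∘ suc) x≤n) ⟩
  (f 0 + g 0) + (sumBelow x (f ∘ suc) + sumBelow n (g ∘ suc))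
    ≡⟨ interchange (f 0) (g 0) _ _ ⟩
  (f 0 + sumBelow x (f ∘ suc)) + (g 0 + sumBelow n (g ∘ suc)) ∎
  where open ≡-Reasoning

r+[1+m]*l+l≡r+[2+m]*l : ∀ r m l → r + suc m * l + l ≡ r + suc (suc m) * l
r+[1+m]*l+l≡r+[2+m]*l = solve-∀

-- Counting words

#words : (n m : ℕ) → (Vec (Fin n) m → Bool) → ℕ
#words n zero    p = if p [] then 1 else 0
#words n (suc m) p = ∑[ x < n ] #words n m (λ w → p (x ∷ w))

#words-cong : ∀ n m {p q : Vec (Fin n) m → Bool} → (∀ w → p w ≡ q w) → #words n m p ≡ #words n m q
#words-cong n zero    p≗q = cong (if_then 1 else 0) (p≗q [])
#words-cong n (suc m) p≗q = sum-cong-≗ (λ x → #words-cong n m (λ w → p≗q (x ∷ w)))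

#words-none : ∀ n m {p : Vec (Fin n) m → Bool} → (∀ w → p w ≡ false) → #words n m p ≡ 0
#words-none n zero    p≗false = cong (if_then 1 else 0) (p≗false [])
#words-none n (suc m) p≗false =
  trans (sum-cong-≗ (λ x → #words-none n m (λ w → p≗false (x ∷ w)))) (sum-replicate-zero n)

#words-∧-const : ∀ n m (p : Vec (Fin n) m → Bool) b →
  #words n m (λ w → p w ∧ b) ≡ (if b then #words n m p else 0)
#words-∧-const n m p true  = #words-cong n m (λ w → ∧-identityʳ (p w))
#words-∧-const n m p false = #words-none n m (λ w → ∧-zeroʳ (p w))

#words-punchIn : ∀ N m (x : Fin (suc N)) {p : Vec (Fin (suc N)) m → Bool} →
  (∀ w → x ∈ w → p w ≡ false) → #words (suc N) m p ≡ #words N m (p ∘ Vec.map (punchIn x))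
#words-punchIn N zero    x _              = refl
#words-punchIn N (suc m) x {p} x∈⇒false =
  trans (sum-remove {i = x} (λ y → #words (suc N) m (λ w → p (y ∷ w))))
        (cong₂ _+_ (#words-none (suc N) m (λ w → x∈⇒false (x ∷ w) (here refl)))
                   (sum-cong-≗ (λ z → #words-punchIn N m x (λ w x∈w →
                      x∈⇒false (punchIn x z ∷ w) (there x∈w)))))

module _ {a p} {A : Set a} {P : Pred A p} (P? : Decidable P) where

  length-filter-map : ∀ {B : Set a} (g : B → A) xs →
    length (filter P? (List.map g xs)) ≡ length (filter (P? ∘ g) xs)
  length-filter-map g []       = refl
  length-filter-map g (x ∷ xs) with does (P? (g x))
  ... | true  = cong suc (length-filter-map g xs)
  ... | false = length-filter-map g xs

  length-filter-concatMap : ∀ {B : Set a} {k} (f : Fin k → B) (h : B → List A) →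
    length (filter P? (concatMap h (tabulate f))) ≡ ∑[ i < k ] length (filter P? (h (f i)))
  length-filter-concatMap {k = zero}  f h = refl
  length-filter-concatMap {k = suc k} f h = begin
    length (filter P? (h (f zero) List.++ concatMap h (tabulate (f ∘ suc))))
      ≡⟨ cong length (filter-++ P? (h (f zero)) _) ⟩
    length (filter P? (h (f zero)) List.++ filter P? (concatMap h (tabulate (f ∘ suc))))
      ≡⟨ length-++ (filter P? (h (f zero))) ⟩
    length (filter P? (h (f zero))) + length (filter P? (concatMap h (tabulate (f ∘ suc))))
      ≡⟨ cong (length (filter P? (h (f zero))) +_) (length-filter-concatMap (f ∘ suc) h) ⟩
    length (filter P? (h (f zero))) + ∑[ i < k ] length (filter P? (h (f (suc i)))) ∎
    where open ≡-Reasoning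

length-filter-words : ∀ n m {p} {P : Pred (Vec (Fin n) m) p} (P? : Decidable P) →
  length (filter P? (words n m)) ≡ #words n m (does ∘ P?)
length-filter-words n zero    P? with does (P? [])
... | true  = refl
... | false = refl
length-filter-words n (suc m) P? =
  trans (length-filter-concatMap P? (λ x → x) (λ x → List.map (x ∷_) (words n m)))
        (sum-cong-≗ (λ x → trans (length-filter-map P? (x ∷_) (words n m))
                                 (length-filter-words n m (P? ∘ (x ∷_)))))

Unique-∷-punchIn : ∀ {N m} (x : Fin (suc N)) (w : Vec (Fin N) m) →
  Unique (toList (x ∷ Vec.map (punchIn x) w)) ⇔ Unique (toList w)
Unique-∷-punchIn x w = mk⇔
  (λ { (_ ∷ u) → Unique.map⁻ (subst Unique (toList-map (punchIn x) w) u) })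
  (λ u → subst (All.All (x ≢_)) (sym (toList-map (punchIn x) w))
                (All.map⁺ (All.universal (λ z → punchInᵢ≢i x z ∘ sym) (toList w)))
         ∷ subst Unique (sym (toList-map (punchIn x) w)) (Unique.map⁺ (λ {j} {k} → punchIn-injective x j k) u))

∈⇒¬Unique-∷ : ∀ {n m} {x : Fin n} {w : Vec (Fin n) m} → x ∈ w → ¬ Unique (toList (x ∷ w))
∈⇒¬Unique-∷ x∈w (x∉w ∷ _) = All.lookup x∉w (∈-toList⁺ x∈w) refl

punchIn-<ᵇ : ∀ {N} (x : Fin (suc N)) (a b : Fin N) →
  (toℕ (punchIn x a) <ᵇ toℕ (punchIn x b)) ≡ (toℕ a <ᵇ toℕ b)
punchIn-<ᵇ zero    a       b       = refl
punchIn-<ᵇ (suc x) zero    zero    = refl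
punchIn-<ᵇ (suc x) zero    (suc b) = refl
punchIn-<ᵇ (suc x) (suc a) zero    = refl
punchIn-<ᵇ (suc x) (suc a) (suc b) = punchIn-<ᵇ x a b

punchIn-<ᵇ-pivot : ∀ {N} (x : Fin (suc N)) (a : Fin N) → (toℕ (punchIn x a) <ᵇ toℕ x) ≡ (toℕ a <ᵇ toℕ x)
punchIn-<ᵇ-pivot zero    a       = refl
punchIn-<ᵇ-pivot (suc x) zero    = refl
punchIn-<ᵇ-pivot (suc x) (suc a) = punchIn-<ᵇ-pivot x a

desL-map-punchIn : ∀ {N m} (x : Fin (suc N)) (w : Vec (Fin N) m) →
  desL (toList (Vec.map (punchIn x) w)) ≡ desL (toList w)
desL-map-punchIn x []          = refl
desL-map-punchIn x (a ∷ [])    = refl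
desL-map-punchIn x (a ∷ b ∷ w) =
  cong₂ _+_ (cong (if_then 1 else 0) (punchIn-<ᵇ x b a)) (desL-map-punchIn x (b ∷ w))

desL-∷-punchIn : ∀ {N m} (x : Fin (suc N)) (y : Fin N) (w : Vec (Fin N) m) →
  desL (toList (x ∷ Vec.map (punchIn x) (y ∷ w)))
  ≡ (if toℕ y <ᵇ toℕ x then 1 else 0) + desL (toList (y ∷ w))
desL-∷-punchIn x y w =
  cong₂ _+_ (cong (if_then 1 else 0) (punchIn-<ᵇ-pivot x y)) (desL-map-punchIn x (y ∷ w))

-- Refined Eulerian numbers

oneFewer : (ℕ → ℕ → ℕ) → ℕ → ℕ → ℕ
oneFewer f zero    = λ _ → 0
oneFewer f (suc d) = f d

-- refinedEulerian m d x is the number of π ∈ S_{m+1} with d descents and π(1) = x + 1.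
refinedEulerian : ℕ → ℕ → ℕ → ℕ
refinedEulerian zero    zero    zero = 1
refinedEulerian zero    _       _    = 0
refinedEulerian (suc m) d       x    =
  sumBelow (suc m) (piecewise x (oneFewer (refinedEulerian m) d) (refinedEulerian m d))

permsStartingWith : (m d : ℕ) → Fin (suc m) → ℕ
permsStartingWith m d x = #words (suc m) m (λ w → does (isPerm? (x ∷ w)) ∧ does (Des (x ∷ w) ℕ.≟ d))

permsStartingWith≡refinedEulerian : ∀ m d x → permsStartingWith m d x ≡ refinedEulerian m d (toℕ x)
permsStartingWith≡refinedEulerian zero    zero    zero = refl
permsStartingWith≡refinedEulerian zero    (suc d) zero = refl
permsStartingWith≡refinedEulerian (suc m) d       x    = begin
  #words (suc (suc m)) (suc m) isPermWithDes
    ≡⟨ #words-punchIn (suc m) (suc m) x repeated⇒false ⟩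
  ∑[ y < suc m ] #words (suc m) m (λ w → isPermWithDes (Vec.map (punchIn x) (y ∷ w)))
    ≡⟨ sum-cong-≗ (λ y → #words-cong (suc m) m (λ w → cong₂ _∧_
         (does-⇔ (Unique-∷-punchIn x (y ∷ w)) (isPerm? _) (isPerm? (y ∷ w)))
         (cong (λ k → does (k ℕ.≟ d)) (desL-∷-punchIn x y w)))) ⟩
  ∑[ y < suc m ] #words (suc m) m (λ w → does (isPerm? (y ∷ w)) ∧ does ((descent y + Des (y ∷ w)) ℕ.≟ d))
    ≡⟨ sum-cong-≗ (λ y → tails (toℕ y <ᵇ toℕ x) y) ⟩
  refinedEulerian (suc m) d (toℕ x) ∎
  where
  open ≡-Reasoning
  isPermWithDes : Vec (Fin (suc (suc m))) (suc m) → Bool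
  isPermWithDes w = does (isPerm? (x ∷ w)) ∧ does (Des (x ∷ w) ℕ.≟ d)
  repeated⇒false : ∀ w → x ∈ w → isPermWithDes w ≡ false
  repeated⇒false w x∈w =
    cong (_∧ does (Des (x ∷ w) ℕ.≟ d)) (dec-false (isPerm? (x ∷ w)) (∈⇒¬Unique-∷ x∈w))
  descent : Fin (suc m) → ℕ
  descent y = if toℕ y <ᵇ toℕ x then 1 else 0
  tailsAfterDescent : ∀ d y →
    #words (suc m) m (λ w → does (isPerm? (y ∷ w)) ∧ does (suc (Des (y ∷ w)) ℕ.≟ d))
    ≡ oneFewer (refinedEulerian m) d (toℕ y)
  tailsAfterDescent zero    y = #words-none (suc m) m (λ w → ∧-zeroʳ _)
  tailsAfterDescent (suc d) y = permsStartingWith≡refinedEulerian m d y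
  tails : ∀ c y →
    #words (suc m) m (λ w → does (isPerm? (y ∷ w)) ∧ does (((if c then 1 else 0) + Des (y ∷ w)) ℕ.≟ d))
    ≡ (if c then oneFewer (refinedEulerian m) d (toℕ y) else refinedEulerian m d (toℕ y))
  tails true  y = tailsAfterDescent d y
  tails false y = permsStartingWith≡refinedEulerian m d y

countDes≡sumBelow : ∀ m d → countDes (suc m) d ≡ sumBelow (suc m) (refinedEulerian m d)
countDes≡sumBelow m d = trans (length-filter-words (suc m) (suc m) _)
                              (sum-cong-≗ (permsStartingWith≡refinedEulerian m d))

countDesFirst≡refinedEulerian : ∀ m d {x} → x ≤ m → countDesFirst m d (suc x) ≡ refinedEulerian m d x
countDesFirst≡refinedEulerian m d {x} x≤m = begin
  countDesFirst m d (suc x)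
    ≡⟨ length-filter-words (suc m) (suc m) _ ⟩
  ∑[ y < suc m ] #words (suc m) m (λ w → does (isPerm? (y ∷ w)) ∧ (does (Des (y ∷ w) ℕ.≟ d) ∧ (toℕ y ≡ᵇ x)))
    ≡⟨ sum-cong-≗ firstLetter ⟩
  sumBelow (suc m) (λ y → if y ≡ᵇ x then refinedEulerian m d y else 0)
    ≡⟨ sumBelow-indicator (suc m) (refinedEulerian m d) (s≤s x≤m) ⟩
  refinedEulerian m d x ∎
  where
  open ≡-Reasoning
  firstLetter : ∀ y →
    #words (suc m) m (λ w → does (isPerm? (y ∷ w)) ∧ (does (Des (y ∷ w) ℕ.≟ d) ∧ (toℕ y ≡ᵇ x)))
    ≡ (if toℕ y ≡ᵇ x then refinedEulerian m d (toℕ y) else 0)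
  firstLetter y = begin
    #words (suc m) m (λ w → does (isPerm? (y ∷ w)) ∧ (does (Des (y ∷ w) ℕ.≟ d) ∧ (toℕ y ≡ᵇ x)))
      ≡⟨ #words-cong (suc m) m (λ w → sym (∧-assoc (does (isPerm? (y ∷ w))) _ _)) ⟩
    #words (suc m) m (λ w → (does (isPerm? (y ∷ w)) ∧ does (Des (y ∷ w) ℕ.≟ d)) ∧ (toℕ y ≡ᵇ x))
      ≡⟨ #words-∧-const (suc m) m _ (toℕ y ≡ᵇ x) ⟩
    (if toℕ y ≡ᵇ x then permsStartingWith m d y else 0)
      ≡⟨ cong (if toℕ y ≡ᵇ x then_else 0) (permsStartingWith≡refinedEulerian m d y) ⟩
    (if toℕ y ≡ᵇ x then refinedEulerian m d (toℕ y) else 0) ∎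

-- Leading terms

leadingTerm : ℕ → ℕ → ℕ → ℕ
leadingTerm m d x = d ^ x * suc d ^ (m ∸ x)

leadingTerm-telescope : ∀ m d {x} → x ≤ suc m →
  sumBelow x (leadingTerm m d) + leadingTerm (suc m) d x ≡ suc d ^ suc m
leadingTerm-telescope m d {zero}  _         = +-identityʳ (suc d ^ suc m)
leadingTerm-telescope m d {suc x} (s≤s x≤m) = begin
  sumBelow (suc x) (leadingTerm m d) + d ^ suc x * suc d ^ (m ∸ x)
    ≡⟨ cong (_+ d ^ suc x * suc d ^ (m ∸ x)) (sumBelow-snoc x (leadingTerm m d)) ⟩
  S + d ^ x * suc d ^ (m ∸ x) + d * d ^ x * suc d ^ (m ∸ x)
    ≡⟨ trans (+-assoc S _ _) (cong (S +_) (merge (d ^ x) (suc d ^ (m ∸ x)) d)) ⟩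
  S + d ^ x * suc d ^ suc (m ∸ x)
    ≡⟨ cong (λ k → S + d ^ x * suc d ^ k) (sym (+-∸-assoc 1 x≤m)) ⟩
  S + leadingTerm (suc m) d x
    ≡⟨ leadingTerm-telescope m d (m≤n⇒m≤1+n x≤m) ⟩
  suc d ^ suc m ∎
  where
  open ≡-Reasoning
  S : ℕ
  S = sumBelow x (leadingTerm m d)
  merge : ∀ p q d → p * q + d * p * q ≡ p * ((1 + d) * q)
  merge = solve-∀

sumBelow-leadingTerm : ∀ m d → sumBelow (suc m) (leadingTerm m d) + d ^ suc m ≡ suc d ^ suc m
sumBelow-leadingTerm m d = begin
  sumBelow (suc m) (leadingTerm m d) + d ^ suc m
    ≡⟨ cong (sumBelow (suc m) (leadingTerm m d) +_)
            (sym (trans (cong (λ k → d ^ suc m * suc d ^ k) (n∸n≡0 m)) (*-identityʳ _))) ⟩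
  sumBelow (suc m) (leadingTerm m d) + leadingTerm (suc m) d (suc m)
    ≡⟨ leadingTerm-telescope m d ≤-refl ⟩
  suc d ^ suc m ∎
  where open ≡-Reasoning

oneFewer-telescope : ∀ m d {x} → x ≤ suc m →
  sumBelow x (oneFewer (leadingTerm m) d) + oneFewer (leadingTerm (suc m)) d x ≡ d ^ suc m
oneFewer-telescope m zero    {x} _    = trans (+-identityʳ _) (sum-replicate-zero x)
oneFewer-telescope m (suc d)     x≤sm = leadingTerm-telescope m d x≤sm

-- The recurrence of refinedEulerian, except for the boundary term oneFewer (leadingTerm (suc m)) d x,
-- which is where the error in the lower bound comes from.
leadingTerm-recurrence : ∀ m d {x} → x ≤ suc m →
  sumBelow (suc m) (piecewise x (oneFewer (leadingTerm m) d) (leadingTerm m d)) + oneFewer (leadingTerm (suc m)) d x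
  ≡ leadingTerm (suc m) d x
leadingTerm-recurrence m d {x} x≤sm = +-cancelʳ-≡ (Σg x + d ^ suc m) _ _ (begin
  (S + B) + (Σg x + d ^ suc m)           ≡⟨ interchange S B (Σg x) _ ⟩
  (S + Σg x) + (B + d ^ suc m)           ≡⟨ cong (_+ (B + d ^ suc m)) (∑-piecewise (suc m) f g x≤sm) ⟩
  (Σf x + Σg (suc m)) + (B + d ^ suc m)  ≡⟨ interchange (Σf x) _ B _ ⟩
  (Σf x + B) + (Σg (suc m) + d ^ suc m)  ≡⟨ cong₂ _+_ (oneFewer-telescope m d x≤sm) (sumBelow-leadingTerm m d) ⟩
  d ^ suc m + suc d ^ suc m              ≡⟨ cong (d ^ suc m +_) (sym (leadingTerm-telescope m d x≤sm)) ⟩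
  d ^ suc m + (Σg x + L)                 ≡⟨ rearrange (d ^ suc m) (Σg x) L ⟩
  L + (Σg x + d ^ suc m)                 ∎)
  where
  open ≡-Reasoning
  f g Σf Σg : ℕ → ℕ
  f = oneFewer (leadingTerm m) d
  g = leadingTerm m d
  Σf k = sumBelow k f
  Σg k = sumBelow k g
  S B L : ℕ
  S = sumBelow (suc m) (piecewise x f g)
  B = oneFewer (leadingTerm (suc m)) d x
  L = leadingTerm (suc m) d x
  rearrange : ∀ p s l → p + (s + l) ≡ l + (s + p)
  rearrange = solve-∀

∑-piecewise-leadingTerm≤ : ∀ m d {x} → x ≤ suc m →
  sumBelow (suc m) (piecewise x (oneFewer (leadingTerm m) d) (leadingTerm m d)) ≤ leadingTerm (suc m) d x
∑-piecewise-leadingTerm≤ m d x≤sm = ≤-trans (m≤m+n _ _) (≤-reflexive (leadingTerm-recurrence m d x≤sm))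

refinedEulerian-zero : ∀ m {x} → x ≤ m → refinedEulerian m 0 x ≡ leadingTerm m 0 x
refinedEulerian-zero zero    {zero} _    = refl
refinedEulerian-zero (suc m) {x}    x≤sm = begin
  sumBelow (suc m) (piecewise x (λ _ → 0) (refinedEulerian m 0))
    ≡⟨ sumBelow-cong (suc m) (λ y y<sm →
         cong (if y <ᵇ x then 0 else_) (refinedEulerian-zero m (≤-pred y<sm))) ⟩
  sumBelow (suc m) (piecewise x (λ _ → 0) (leadingTerm m 0))
    ≡⟨ sym (+-identityʳ _) ⟩
  sumBelow (suc m) (piecewise x (λ _ → 0) (leadingTerm m 0)) + 0
    ≡⟨ leadingTerm-recurrence m 0 x≤sm ⟩
  leadingTerm (suc m) 0 x ∎
  where open ≡-Reasoning

oneFewer-mono : ∀ (f g : ℕ → ℕ → ℕ) {y} → (∀ d → f d y ≤ g d y) → ∀ d → oneFewer f d y ≤ oneFewer g d y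
oneFewer-mono f g f≤g zero    = z≤n
oneFewer-mono f g f≤g (suc d) = f≤g d

refinedEulerian≤leadingTerm : ∀ m d {x} → x ≤ m → refinedEulerian m d x ≤ leadingTerm m d x
refinedEulerian≤leadingTerm zero    zero    {zero} _    = ≤-refl
refinedEulerian≤leadingTerm zero    (suc d) {zero} _    = z≤n
refinedEulerian≤leadingTerm (suc m) d       {x}    x≤sm =
  ≤-trans (sumBelow-mono (suc m) termwise) (∑-piecewise-leadingTerm≤ m d x≤sm)
  where
  termwise : ∀ y → y < suc m → piecewise x (oneFewer (refinedEulerian m) d) (refinedEulerian m d) y
                                 ≤ piecewise x (oneFewer (leadingTerm m) d) (leadingTerm m d) y
  termwise y y<sm = if-mono (y <ᵇ x)
    (oneFewer-mono (refinedEulerian m) (leadingTerm m) (λ d′ → refinedEulerian≤leadingTerm m d′ (≤-pred y<sm)) d)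
    (refinedEulerian≤leadingTerm m d (≤-pred y<sm))

leadingTerm≤refinedEulerian+ : ∀ m d {x} → x ≤ m →
  leadingTerm m d x ≤ refinedEulerian m d x + suc m * oneFewer (leadingTerm m) d x
leadingTerm≤refinedEulerian+ m       zero    {x}    x≤m  =
  ≤-trans (≤-reflexive (sym (refinedEulerian-zero m x≤m))) (m≤m+n _ _)
leadingTerm≤refinedEulerian+ zero    (suc a) {zero} _    = ≤-refl
leadingTerm≤refinedEulerian+ (suc m) (suc a) {x}    x≤sm = begin
  leadingTerm (suc m) (suc a) x
    ≡⟨ sym (leadingTerm-recurrence m (suc a) x≤sm) ⟩
  sumBelow (suc m) (piecewise x (L a) (L (suc a))) + L′
    ≤⟨ +-monoˡ-≤ L′ (sumBelow-mono (suc m) termwise) ⟩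
  sumBelow (suc m) (λ y → piecewise x (E a) (E (suc a)) y + piecewise x (err (oneFewer L a)) (err (L a)) y) + L′
    ≡⟨ cong (_+ L′) (sumBelow-+ (suc m) (piecewise x (E a) (E (suc a)))
                                         (piecewise x (err (oneFewer L a)) (err (L a)))) ⟩
  E′ + sumBelow (suc m) (piecewise x (err (oneFewer L a)) (err (L a))) + L′
    ≡⟨ cong (λ s → E′ + s + L′) (∑-piecewise-* (suc m) x (suc m) (oneFewer L a) (L a)) ⟩
  E′ + suc m * sumBelow (suc m) (piecewise x (oneFewer L a) (L a)) + L′
    ≤⟨ +-monoˡ-≤ L′ (+-monoʳ-≤ E′ (*-monoʳ-≤ (suc m) (∑-piecewise-leadingTerm≤ m a x≤sm))) ⟩
  E′ + suc m * L′ + L′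
    ≡⟨ r+[1+m]*l+l≡r+[2+m]*l E′ m L′ ⟩
  E′ + suc (suc m) * L′ ∎
  where
  open ≤-Reasoning
  L E : ℕ → ℕ → ℕ
  L = leadingTerm m
  E = refinedEulerian m
  L′ E′ : ℕ
  L′ = leadingTerm (suc m) a x
  E′ = refinedEulerian (suc m) (suc a) x
  err : (ℕ → ℕ) → ℕ → ℕ
  err f y = suc m * f y
  termwise : ∀ y → y < suc m → piecewise x (L a) (L (suc a)) y
                                 ≤ piecewise x (E a) (E (suc a)) y + piecewise x (err (oneFewer L a)) (err (L a)) y
  termwise y y<sm = ≤-trans
    (if-mono (y <ᵇ x) (leadingTerm≤refinedEulerian+ m a (≤-pred y<sm))
                      (leadingTerm≤refinedEulerian+ m (suc a) (≤-pred y<sm)))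
    (≤-reflexive (piecewise-+ x y (E a) (err (oneFewer L a)) (E (suc a)) (err (L a))))

sumBelow-refinedEulerian≤ : ∀ m d → sumBelow (suc m) (refinedEulerian m d) ≤ suc d ^ suc m
sumBelow-refinedEulerian≤ m d = begin
  sumBelow (suc m) (refinedEulerian m d)
    ≤⟨ sumBelow-mono (suc m) (λ x x<sm → refinedEulerian≤leadingTerm m d (≤-pred x<sm)) ⟩
  sumBelow (suc m) (leadingTerm m d)
    ≤⟨ m≤m+n _ (d ^ suc m) ⟩
  sumBelow (suc m) (leadingTerm m d) + d ^ suc m
    ≡⟨ sumBelow-leadingTerm m d ⟩
  suc d ^ suc m ∎
  where open ≤-Reasoning

sumBelow-refinedEulerian≥ : ∀ m a →
  suc (suc a) ^ suc m ≤ sumBelow (suc m) (refinedEulerian m (suc a)) + suc (suc m) * suc a ^ suc m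
sumBelow-refinedEulerian≥ m a = begin
  suc (suc a) ^ suc m
    ≡⟨ sym (sumBelow-leadingTerm m (suc a)) ⟩
  sumBelow (suc m) (leadingTerm m (suc a)) + suc a ^ suc m
    ≤⟨ +-monoˡ-≤ (suc a ^ suc m)
         (sumBelow-mono (suc m) (λ x x<sm → leadingTerm≤refinedEulerian+ m (suc a) (≤-pred x<sm))) ⟩
  sumBelow (suc m) (λ x → refinedEulerian m (suc a) x + suc m * leadingTerm m a x) + suc a ^ suc m
    ≡⟨ cong (_+ suc a ^ suc m) (trans (sumBelow-+ (suc m) (refinedEulerian m (suc a)) (λ x → suc m * leadingTerm m a x))
                                      (cong (A +_) (sumBelow-* (suc m) (suc m) (leadingTerm m a)))) ⟩
  A + suc m * sumBelow (suc m) (leadingTerm m a) + suc a ^ suc m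
    ≤⟨ +-monoˡ-≤ (suc a ^ suc m) (+-monoʳ-≤ A (*-monoʳ-≤ (suc m)
         (≤-trans (m≤m+n _ (a ^ suc m)) (≤-reflexive (sumBelow-leadingTerm m a))))) ⟩
  A + suc m * suc a ^ suc m + suc a ^ suc m
    ≡⟨ r+[1+m]*l+l≡r+[2+m]*l A m (suc a ^ suc m) ⟩
  A + suc (suc m) * suc a ^ suc m ∎
  where
  open ≤-Reasoning
  A : ℕ
  A = sumBelow (suc m) (refinedEulerian m (suc a))

-- Growth of (D + 1)^m against D^m

-- (1 + 1/D)^m ≥ 1 + m/D + m(m - 1)/(2D²), cleared of denominators.
binomial-second-order : ∀ D m → (2 * D * D + 2 * m * D + m * m) * D ^ m ≤ 2 * D * D * suc D ^ m + m * D ^ m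
binomial-second-order D zero    = ≤-trans (≤-reflexive (base D)) (m≤m+n _ 0)
  where
  base : ∀ D → (2 * D * D + 2 * 0 * D + 0 * 0) * 1 ≡ 2 * D * D * 1
  base = solve-∀
binomial-second-order D (suc m) = +-cancelʳ-≤ (m * m * Z) _ _ (begin
  (2 * D * D + 2 * suc m * D + suc m * suc m) * (D * Z) + m * m * Z
    ≡⟨ expand D m Z ⟩
  (2 * D * D + 2 * m * D + m * m) * Z * suc D + D * Z
    ≤⟨ +-monoˡ-≤ (D * Z) (*-monoˡ-≤ (suc D) (binomial-second-order D m)) ⟩
  (2 * D * D * W + m * Z) * suc D + D * Z
    ≡⟨ regroup D m Z W ⟩
  2 * D * D * (W + D * W) + suc m * (D * Z) + m * Z
    ≤⟨ +-monoʳ-≤ (2 * D * D * (W + D * W) + suc m * (D * Z)) (*-monoˡ-≤ Z (m≤m*m m)) ⟩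
  2 * D * D * (W + D * W) + suc m * (D * Z) + m * m * Z ∎)
  where
  open ≤-Reasoning
  Z W : ℕ
  Z = D ^ m
  W = suc D ^ m
  m≤m*m : ∀ m → m ≤ m * m
  m≤m*m zero    = z≤n
  m≤m*m (suc m) = m≤m*n (suc m) (suc m)
  expand : ∀ D m Z → (2 * D * D + 2 * (1 + m) * D + (1 + m) * (1 + m)) * (D * Z) + m * m * Z
                     ≡ (2 * D * D + 2 * m * D + m * m) * Z * (1 + D) + D * Z
  expand = solve-∀
  regroup : ∀ D m Z W →
    (2 * D * D * W + m * Z) * (1 + D) + D * Z ≡ 2 * D * D * (W + D * W) + (1 + m) * (D * Z) + m * Z
  regroup = solve-∀

-- The threshold makes m² exceed 2D²c(m + 2) + m; the binomial bound then turns m² D^m into 2D² (D + 1)^m.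
linear*pow<pow-suc : ∀ a c m → 4 * suc a * suc a * c + 2 ≤ m → c * (m + 2) * suc a ^ m < suc (suc a) ^ m
linear*pow<pow-suc a c m m≥ = *-cancelˡ-< (2 * D * D) _ _ (+-cancelʳ-< (m * Z) _ _ (begin-strict
  2 * D * D * (c * (m + 2) * Z) + m * Z   ≡⟨ factor c m Z D ⟩
  (2 * (D * D * c) * (m + 2) + m) * Z     <⟨ *-monoˡ-< Z {{>-nonZero (m^n>0 D m)}} quadratic ⟩
  m * m * Z                               ≤⟨ m≤n+m (m * m * Z) ((2 * D * D + 2 * m * D) * Z) ⟩
  (2 * D * D + 2 * m * D) * Z + m * m * Z ≡⟨ sym (*-distribʳ-+ Z (2 * D * D + 2 * m * D) (m * m)) ⟩
  (2 * D * D + 2 * m * D + m * m) * Z     ≤⟨ binomial-second-order D m ⟩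
  2 * D * D * suc D ^ m + m * Z           ∎))
  where
  open ≤-Reasoning
  D Z : ℕ
  D = suc a
  Z = D ^ m
  factor : ∀ c m Z D → 2 * D * D * (c * (m + 2) * Z) + m * Z ≡ (2 * (D * D * c) * (m + 2) + m) * Z
  factor = solve-∀
  quadratic : 2 * (D * D * c) * (m + 2) + m < m * m
  quadratic with m≤n⇒∃[o]m+o≡n m≥
  ... | t , refl = m+n≤o⇒m≤o _ (≤-reflexive (expansion D c t))
    where
    expansion : ∀ D c t → suc (2 * (D * D * c) * ((4 * D * D * c + 2 + t) + 2) + (4 * D * D * c + 2 + t))
                          + (8 * (D * D * c) * (D * D * c) + 4 * (D * D * c) + 1 + 6 * (D * D * c) * t + 3 * t + t * t)
                          ≡ (4 * D * D * c + 2 + t) * (4 * D * D * c + 2 + t)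
    expansion = solve-∀

a^x*[2+a]^x≤[1+a]^x*[1+a]^x : ∀ a x → a ^ x * (2 + a) ^ x ≤ suc a ^ x * suc a ^ x
a^x*[2+a]^x≤[1+a]^x*[1+a]^x a zero    = ≤-refl
a^x*[2+a]^x≤[1+a]^x*[1+a]^x a (suc x) = begin
  (a * a ^ x) * ((2 + a) * (2 + a) ^ x)     ≡⟨ interchange-* a (a ^ x) (2 + a) _ ⟩
  (a * (2 + a)) * (a ^ x * (2 + a) ^ x)     ≤⟨ *-mono-≤ (≤-trans (m≤m+n _ 1) (≤-reflexive (square a)))
                                                        (a^x*[2+a]^x≤[1+a]^x*[1+a]^x a x) ⟩
  (suc a * suc a) * (suc a ^ x * suc a ^ x) ≡⟨ interchange-* (suc a) (suc a) (suc a ^ x) _ ⟩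
  (suc a * suc a ^ x) * (suc a * suc a ^ x) ∎
  where
  open ≤-Reasoning
  interchange-* : ∀ p q r s → (p * q) * (r * s) ≡ (p * r) * (q * s)
  interchange-* = solve-∀
  square : ∀ a → a * (2 + a) + 1 ≡ (1 + a) * (1 + a)
  square = solve-∀

leadingTerm*[1+d]^[1+x] : ∀ m d {x} → x ≤ m → leadingTerm m d x * suc d ^ suc x ≡ d ^ x * suc d ^ suc m
leadingTerm*[1+d]^[1+x] m d {x} x≤m = begin
  d ^ x * suc d ^ (m ∸ x) * suc d ^ suc x   ≡⟨ *-assoc (d ^ x) _ _ ⟩
  d ^ x * (suc d ^ (m ∸ x) * suc d ^ suc x) ≡⟨ cong (d ^ x *_) (sym (^-distribˡ-+-* (suc d) (m ∸ x) (suc x))) ⟩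
  d ^ x * suc d ^ ((m ∸ x) + suc x)
    ≡⟨ cong (λ k → d ^ x * suc d ^ k) (trans (+-suc (m ∸ x) x) (cong suc (m∸n+n≡m x≤m))) ⟩
  d ^ x * suc d ^ suc m                     ∎
  where open ≡-Reasoning

-- D^x · slack m D over D^x (D + 1)^(m+1) is (m + 2)(D/(D + 1))^m: the relative error, uniform in x.
slack : ℕ → ℕ → ℕ
slack m D = (m + 2) * suc D * D ^ m

-- Here a^x (a + 2)^x ≤ (a + 1)^(2x) removes the dependence on x.
leadingTerm-error≤slack : ∀ m a {x} → x ≤ m →
  suc m * leadingTerm m a x * (2 + a) ^ suc x ≤ suc a ^ x * slack m (suc a)
leadingTerm-error≤slack m a {x} x≤m = begin
  suc m * (a ^ x * D ^ (m ∸ x)) * (suc D * suc D ^ x)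
    ≡⟨ regroup (suc m) (a ^ x) (D ^ (m ∸ x)) (suc D) (suc D ^ x) ⟩
  suc m * suc D * D ^ (m ∸ x) * (a ^ x * suc D ^ x)
    ≤⟨ *-monoʳ-≤ (suc m * suc D * D ^ (m ∸ x)) (a^x*[2+a]^x≤[1+a]^x*[1+a]^x a x) ⟩
  suc m * suc D * D ^ (m ∸ x) * (D ^ x * D ^ x)
    ≡⟨ regroup′ (suc m) (suc D) (D ^ (m ∸ x)) (D ^ x) ⟩
  D ^ x * (suc m * suc D * (D ^ x * D ^ (m ∸ x)))
    ≡⟨ cong (λ k → D ^ x * (suc m * suc D * k))
            (trans (sym (^-distribˡ-+-* D x (m ∸ x))) (cong (D ^_) (m+[n∸m]≡n x≤m))) ⟩
  D ^ x * (suc m * suc D * D ^ m)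
    ≤⟨ *-monoʳ-≤ (D ^ x) (*-monoˡ-≤ (D ^ m) (*-monoˡ-≤ (suc D)
         (≤-trans (n≤1+n (suc m)) (≤-reflexive (+-comm 2 m))))) ⟩
  D ^ x * slack m D ∎
  where
  open ≤-Reasoning
  D : ℕ
  D = suc a
  regroup : ∀ s p q b r → s * (p * q) * (b * r) ≡ s * b * q * (p * r)
  regroup = solve-∀
  regroup′ : ∀ s b q d → s * b * q * (d * d) ≡ d * (s * b * (d * q))
  regroup′ = solve-∀

refinedEulerian-scaled-bounds : ∀ m a {x} → x ≤ m →
  refinedEulerian m (suc a) x * (2 + a) ^ suc x ≤ suc a ^ x * (2 + a) ^ suc m
  × suc a ^ x * (2 + a) ^ suc m ≤ refinedEulerian m (suc a) x * (2 + a) ^ suc x + suc a ^ x * slack m (suc a)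
refinedEulerian-scaled-bounds m a {x} x≤m =
  ≤-trans (*-monoˡ-≤ B (refinedEulerian≤leadingTerm m D x≤m)) (≤-reflexive (leadingTerm*[1+d]^[1+x] m D x≤m)) ,
  (begin
    D ^ x * suc D ^ suc m                  ≡⟨ sym (leadingTerm*[1+d]^[1+x] m D x≤m) ⟩
    leadingTerm m D x * B                  ≤⟨ *-monoˡ-≤ B (leadingTerm≤refinedEulerian+ m D x≤m) ⟩
    (P + suc m * leadingTerm m a x) * B    ≡⟨ *-distribʳ-+ B P _ ⟩
    P * B + suc m * leadingTerm m a x * B  ≤⟨ +-monoʳ-≤ (P * B) (leadingTerm-error≤slack m a x≤m) ⟩
    P * B + D ^ x * slack m D              ∎)
  where
  open ≤-Reasoning
  D B P : ℕ
  D = suc a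
  B = suc D ^ suc x
  P = refinedEulerian m D x

sumBelow-refinedEulerian-scaled-bounds : ∀ m a x →
  sumBelow (suc m) (refinedEulerian m (suc a)) * suc a ^ x ≤ suc a ^ x * (2 + a) ^ suc m
  × suc a ^ x * (2 + a) ^ suc m
    ≤ sumBelow (suc m) (refinedEulerian m (suc a)) * suc a ^ x + suc a ^ x * slack m (suc a)
sumBelow-refinedEulerian-scaled-bounds m a x =
  ≤-trans (*-monoˡ-≤ (D ^ x) (sumBelow-refinedEulerian≤ m D)) (≤-reflexive (*-comm _ (D ^ x))) ,
  (begin
    D ^ x * suc D ^ suc m                       ≤⟨ *-monoʳ-≤ (D ^ x) (sumBelow-refinedEulerian≥ m a) ⟩
    D ^ x * (A + suc (suc m) * (D * D ^ m))     ≡⟨ distribute A (D ^ x) m D (D ^ m) ⟩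
    A * D ^ x + D ^ x * ((m + 2) * D * D ^ m)   ≤⟨ +-monoʳ-≤ (A * D ^ x) (*-monoʳ-≤ (D ^ x)
                                                     (*-monoˡ-≤ (D ^ m) (*-monoʳ-≤ (m + 2) (n≤1+n D)))) ⟩
    A * D ^ x + D ^ x * slack m D               ∎)
  where
  open ≤-Reasoning
  D A : ℕ
  D = suc a
  A = sumBelow (suc m) (refinedEulerian m D)
  distribute : ∀ A p m d q → p * (A + (2 + m) * (d * q)) ≡ A * p + p * ((m + 2) * d * q)
  distribute = solve-∀

slack-small : ∀ a T m x → 4 * suc a * suc a * suc T + 2 ≤ m →
  suc T * (suc a ^ x * slack m (suc a)) < suc a ^ x * (2 + a) ^ suc m
slack-small a T m x m≥ = begin-strict
  suc T * (D ^ x * ((m + 2) * suc D * D ^ m)) ≡⟨ regroup (suc T) (D ^ x) (m + 2) (suc D) (D ^ m) ⟩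
  D ^ x * (suc D * (suc T * (m + 2) * D ^ m)) <⟨ *-monoʳ-< (D ^ x) {{>-nonZero (m^n>0 D x)}}
                                                   (*-monoʳ-< (suc D) (linear*pow<pow-suc a (suc T) m m≥)) ⟩
  D ^ x * suc D ^ suc m                       ∎
  where
  open ≤-Reasoning
  D : ℕ
  D = suc a
  regroup : ∀ c p n b q → c * (p * (n * b * q)) ≡ p * (b * (c * n * q))
  regroup = solve-∀

T*V<Y : ∀ T Y V {W} → W ≤ Y + V → suc T * V < W → T * V < Y
T*V<Y T Y V W≤Y+V [1+T]V<W =
  +-cancelʳ-< V (T * V) Y (subst (_< Y + V) (+-comm V (T * V)) (<-≤-trans [1+T]V<W W≤Y+V))

T*X<T*Z+Y : ∀ T X Y Z V {W} → X ≤ W → W ≤ Z + V → T * V < Y → T * X < T * Z + Y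
T*X<T*Z+Y T X Y Z V X≤W W≤Z+V TV<Y = begin-strict
  T * X         ≤⟨ *-monoʳ-≤ T (≤-trans X≤W W≤Z+V) ⟩
  T * (Z + V)   ≡⟨ *-distribˡ-+ T Z V ⟩
  T * Z + T * V <⟨ +-monoʳ-< (T * Z) TV<Y ⟩
  T * Z + Y     ∎
  where open ≤-Reasoning

-- Passing to ℚ

coprime-1 : ∀ a → Coprime a 1
coprime-1 a = coprime-sym (1-coprimeTo a)

ℕtoℚ≡mkℚ : ∀ a → ℕtoℚ a ≡ mkℚ (ℤ.+ a) 0 (coprime-1 a)
ℕtoℚ≡mkℚ a = ℚ.normalize-coprime (coprime-1 a)

ℕtoℚ-+ : ∀ a b → ℕtoℚ (a + b) ≡ ℕtoℚ a +ℚ ℕtoℚ b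
ℕtoℚ-+ a b =
  trans (ℚ./-cong {p₁ = ℤ.+ (a + b)} {q₁ = 1} {p₂ = ℤ.+ a ℤ.* ℤ.+ 1 ℤ.+ ℤ.+ b ℤ.* ℤ.+ 1} {q₂ = 1}
                  numerators refl)
        (sym (cong₂ _+ℚ_ (ℕtoℚ≡mkℚ a) (ℕtoℚ≡mkℚ b)))
  where
  numerators : ℤ.+ (a + b) ≡ ℤ.+ a ℤ.* ℤ.+ 1 ℤ.+ ℤ.+ b ℤ.* ℤ.+ 1
  numerators = trans (ℤ.pos-+ a b) (sym (cong₂ ℤ._+_ (ℤ.*-identityʳ (ℤ.+ a)) (ℤ.*-identityʳ (ℤ.+ b))))

ℕtoℚ-* : ∀ a b → ℕtoℚ (a * b) ≡ ℕtoℚ a *ℚ ℕtoℚ b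
ℕtoℚ-* a b =
  trans (ℚ./-cong {p₁ = ℤ.+ (a * b)} {q₁ = 1} {p₂ = ℤ.+ a ℤ.* ℤ.+ b} {q₂ = 1} (ℤ.pos-* a b) refl)
        (sym (cong₂ _*ℚ_ (ℕtoℚ≡mkℚ a) (ℕtoℚ≡mkℚ b)))

ℕtoℚ-mono-< : ∀ {a b} → a < b → ℕtoℚ a <ℚ ℕtoℚ b
ℕtoℚ-mono-< {a} {b} a<b rewrite ℕtoℚ≡mkℚ a | ℕtoℚ≡mkℚ b =
  ℚ.*<* (subst₂ ℤ._<_ (sym (ℤ.*-identityʳ (ℤ.+ a))) (sym (ℤ.*-identityʳ (ℤ.+ b))) (ℤ.+<+ a<b))

ℕtoℚ-mono-≤ : ∀ {a b} → a ≤ b → ℕtoℚ a ≤ℚ ℕtoℚ b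
ℕtoℚ-mono-≤ {a} {b} a≤b rewrite ℕtoℚ≡mkℚ a | ℕtoℚ≡mkℚ b =
  ℚ.*≤* (subst₂ ℤ._≤_ (sym (ℤ.*-identityʳ (ℤ.+ a))) (sym (ℤ.*-identityʳ (ℤ.+ b))) (ℤ.+≤+ a≤b))

ℕtoℚ-nonNeg : ∀ a → ℚ.NonNegative (ℕtoℚ a)
ℕtoℚ-nonNeg a = ℚ.nonNegative (ℕtoℚ-mono-≤ {0} {a} z≤n)

ℕtoℚ≡0⇒≡0 : ∀ a → ℕtoℚ a ≡ 0ℚ → a ≡ 0
ℕtoℚ≡0⇒≡0 a eq = ℤ.+-injective (cong ℚ.↥_ (trans (sym (ℕtoℚ≡mkℚ a)) eq))

interchange-*ℚ : ∀ p q r s → (p *ℚ q) *ℚ (r *ℚ s) ≡ (p *ℚ r) *ℚ (q *ℚ s)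
interchange-*ℚ = solve 4 (λ p q r s → (p :* q) :* (r :* s) := (p :* r) :* (q :* s)) refl

÷₀-*-cancel : ∀ p q → q ≢ 0ℚ → (p ÷₀ q) *ℚ q ≡ p
÷₀-*-cancel p q q≢0 with q ℚ.≟ 0ℚ
... | yes q≡0 = ⊥-elim (q≢0 q≡0)
... | no  q≢0′ = trans (ℚ.*-assoc p (ℚ.1/ q) q) (trans (cong (p *ℚ_) (ℚ.*-inverseˡ q)) (ℚ.*-identityʳ p))
  where instance _ = ℚ.≢-nonZero q≢0′

/-*-cancel : ∀ n k → (ℤ.+ n ℚ./ suc k) *ℚ ℕtoℚ (suc k) ≡ ℕtoℚ n
/-*-cancel n k = ℚ.toℚᵘ-injective (begin
  toℚᵘ ((ℤ.+ n ℚ./ suc k) *ℚ ℕtoℚ (suc k))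
    ≈⟨ ℚ.toℚᵘ-homo-* (ℤ.+ n ℚ./ suc k) (ℕtoℚ (suc k)) ⟩
  toℚᵘ (ℤ.+ n ℚ./ suc k) ℚᵘ.* toℚᵘ (ℕtoℚ (suc k))
    ≈⟨ ℚᵘ.*-cong (ℚ.toℚᵘ-fromℚᵘ (ℚᵘ.mkℚᵘ (ℤ.+ n) k))
                 (ℚᵘ.≃-reflexive (cong toℚᵘ (ℕtoℚ≡mkℚ (suc k)))) ⟩
  ℚᵘ.mkℚᵘ (ℤ.+ n) k ℚᵘ.* ℚᵘ.mkℚᵘ (ℤ.+ suc k) 0
    ≈⟨ ℚᵘ.*≡* (ℤ.*-assoc (ℤ.+ n) (ℤ.+ suc k) (ℤ.+ 1)) ⟩
  ℚᵘ.mkℚᵘ (ℤ.+ n) 0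
    ≈⟨ ℚᵘ.≃-reflexive (cong toℚᵘ (sym (ℕtoℚ≡mkℚ n))) ⟩
  toℚᵘ (ℕtoℚ n) ∎)
  where open ℚᵘ.≃-Reasoning

[1-pOf]*[1+d] : ∀ d → (1ℚ - pOf d) *ℚ ℕtoℚ (suc d) ≡ 1ℚ
[1-pOf]*[1+d] d = begin
  (1ℚ - pOf d) *ℚ ℕtoℚ (suc d)        ≡⟨ distrib (pOf d) (ℕtoℚ (suc d)) ⟩
  ℕtoℚ (suc d) - pOf d *ℚ ℕtoℚ (suc d) ≡⟨ cong₂ _-_ (ℕtoℚ-+ 1 d) (/-*-cancel d d) ⟩
  (1ℚ +ℚ ℕtoℚ d) - ℕtoℚ d               ≡⟨ cancel (ℕtoℚ d) ⟩
  1ℚ                                   ∎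
  where
  open ≡-Reasoning
  distrib : ∀ p b → (1ℚ - p) *ℚ b ≡ b - p *ℚ b
  distrib = solve 2 (λ p b → (con 1ℚ :- p) :* b := b :- p :* b) refl
  cancel : ∀ x → (1ℚ +ℚ x) - x ≡ 1ℚ
  cancel = solve 1 (λ x → (con 1ℚ :+ x) :- x := con 1ℚ) refl

pOf^x*[1+d]^x : ∀ d x → (pOf d ^ℚ x) *ℚ ℕtoℚ (suc d ^ x) ≡ ℕtoℚ (d ^ x)
pOf^x*[1+d]^x d zero    = ℚ.*-identityˡ 1ℚ
pOf^x*[1+d]^x d (suc x) = begin
  (pOf d *ℚ (pOf d ^ℚ x)) *ℚ ℕtoℚ (suc d * suc d ^ x)
    ≡⟨ cong (pOf d *ℚ (pOf d ^ℚ x) *ℚ_) (ℕtoℚ-* (suc d) (suc d ^ x)) ⟩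
  (pOf d *ℚ (pOf d ^ℚ x)) *ℚ (ℕtoℚ (suc d) *ℚ ℕtoℚ (suc d ^ x))
    ≡⟨ interchange-*ℚ (pOf d) (pOf d ^ℚ x) _ _ ⟩
  (pOf d *ℚ ℕtoℚ (suc d)) *ℚ ((pOf d ^ℚ x) *ℚ ℕtoℚ (suc d ^ x))
    ≡⟨ cong₂ _*ℚ_ (/-*-cancel d d) (pOf^x*[1+d]^x d x) ⟩
  ℕtoℚ d *ℚ ℕtoℚ (d ^ x)
    ≡⟨ sym (ℕtoℚ-* d (d ^ x)) ⟩
  ℕtoℚ (d * d ^ x) ∎
  where open ≡-Reasoning

geom*[1+d]^[1+x] : ∀ d x → geom d (suc x) *ℚ ℕtoℚ (suc d ^ suc x) ≡ ℕtoℚ (d ^ x)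
geom*[1+d]^[1+x] d x = begin
  ((1ℚ - pOf d) *ℚ (pOf d ^ℚ x)) *ℚ ℕtoℚ (suc d * suc d ^ x)
    ≡⟨ cong ((1ℚ - pOf d) *ℚ (pOf d ^ℚ x) *ℚ_) (ℕtoℚ-* (suc d) (suc d ^ x)) ⟩
  ((1ℚ - pOf d) *ℚ (pOf d ^ℚ x)) *ℚ (ℕtoℚ (suc d) *ℚ ℕtoℚ (suc d ^ x))
    ≡⟨ interchange-*ℚ (1ℚ - pOf d) (pOf d ^ℚ x) _ _ ⟩
  ((1ℚ - pOf d) *ℚ ℕtoℚ (suc d)) *ℚ ((pOf d ^ℚ x) *ℚ ℕtoℚ (suc d ^ x))
    ≡⟨ cong₂ _*ℚ_ ([1-pOf]*[1+d] d) (pOf^x*[1+d]^x d x) ⟩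
  1ℚ *ℚ ℕtoℚ (d ^ x)
    ≡⟨ ℚ.*-identityˡ _ ⟩
  ℕtoℚ (d ^ x) ∎
  where open ≡-Reasoning

1≤ε*↧ε : ∀ ε .{{_ : ℚ.Positive ε}} → 1ℚ ≤ℚ ε *ℚ ℕtoℚ (ℚ.↧ₙ ε)
1≤ε*↧ε ε@(mkℚ ℤ.+[1+ n ] k _) = subst (1ℚ ≤ℚ_) ι[1+n]≡ε*↧ε (ℕtoℚ-mono-≤ {1} {suc n} (s≤s z≤n))
  where
  ι[1+n]≡ε*↧ε : ℕtoℚ (suc n) ≡ ε *ℚ ℕtoℚ (suc k)
  ι[1+n]≡ε*↧ε = sym (trans (cong (_*ℚ ℕtoℚ (suc k)) (sym (ℚ.↥p/↧p≡p ε))) (/-*-cancel (suc n) k))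

∣p∣<ε : ∀ {p ε} → p <ℚ ε → ℚ.- p <ℚ ε → ∣ p ∣ <ℚ ε
∣p∣<ε {p} p<ε -p<ε with ℚ.∣p∣≡p∨∣p∣≡-p p
... | inj₁ ∣p∣≡p  = subst (_<ℚ _) (sym ∣p∣≡p) p<ε
... | inj₂ ∣p∣≡-p = subst (_<ℚ _) (sym ∣p∣≡-p) -p<ε

-- Cancelling ℕtoℚ (T * Y) turns the ℕ-inequalities into |v - 1| < 1/T ≤ ε.
∣v-1∣<ε : ∀ v ε T X Y → v *ℚ ℕtoℚ Y ≡ ℕtoℚ X → 1ℚ ≤ℚ ε *ℚ ℕtoℚ T →
  T * X < T * Y + Y → T * Y < T * X + Y → ∣ v - 1ℚ ∣ <ℚ ε
∣v-1∣<ε v ε T X Y vY≡X 1≤εT TX<TY+Y TY<TX+Y =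
  ∣p∣<ε (scaled-below (v - 1ℚ) X Y above TX<TY+Y) (scaled-below (ℚ.- (v - 1ℚ)) Y X below TY<TX+Y)
  where
  t y : ℚ
  t = ℕtoℚ T
  y = ℕtoℚ Y
  ι[TY]≡ : ℕtoℚ (T * Y) ≡ t *ℚ y
  ι[TY]≡ = ℕtoℚ-* T Y
  Y≤ε*ι[TY] : y ≤ℚ ε *ℚ ℕtoℚ (T * Y)
  Y≤ε*ι[TY] = subst₂ _≤ℚ_ (ℚ.*-identityˡ y) (trans (ℚ.*-assoc ε t y) (cong (ε *ℚ_) (sym ι[TY]≡)))
                     (ℚ.*-monoʳ-≤-nonNeg y {{ℕtoℚ-nonNeg Y}} 1≤εT)
  scaled-below : ∀ u A B → u *ℚ ℕtoℚ (T * Y) ≡ ℕtoℚ (T * A) - ℕtoℚ (T * B) →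
                 T * A < T * B + Y → u <ℚ ε
  scaled-below u A B eq TA<TB+Y = ℚ.*-cancelʳ-<-nonNeg (ℕtoℚ (T * Y)) {{ℕtoℚ-nonNeg (T * Y)}} (begin-strict
    u *ℚ ℕtoℚ (T * Y)
      ≡⟨ eq ⟩
    ℕtoℚ (T * A) - ℕtoℚ (T * B)
      <⟨ ℚ.+-monoˡ-< (ℚ.- ℕtoℚ (T * B))
           (subst (ℕtoℚ (T * A) <ℚ_) (ℕtoℚ-+ (T * B) Y) (ℕtoℚ-mono-< TA<TB+Y)) ⟩
    (ℕtoℚ (T * B) +ℚ y) - ℕtoℚ (T * B)
      ≡⟨ cancel (ℕtoℚ (T * B)) y ⟩
    y
      ≤⟨ Y≤ε*ι[TY] ⟩
    ε *ℚ ℕtoℚ (T * Y) ∎)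
    where
    open ℚ.≤-Reasoning
    cancel : ∀ b c → (b +ℚ c) - b ≡ c
    cancel = solve 2 (λ b c → (b :+ c) :- b := c) refl
  above : (v - 1ℚ) *ℚ ℕtoℚ (T * Y) ≡ ℕtoℚ (T * X) - ℕtoℚ (T * Y)
  above = begin
    (v - 1ℚ) *ℚ ℕtoℚ (T * Y)  ≡⟨ cong ((v - 1ℚ) *ℚ_) ι[TY]≡ ⟩
    (v - 1ℚ) *ℚ (t *ℚ y)      ≡⟨ expand v t y ⟩
    t *ℚ (v *ℚ y) - t *ℚ y    ≡⟨ cong₂ (λ p q → t *ℚ p - q) vY≡X (sym ι[TY]≡) ⟩
    t *ℚ ℕtoℚ X - ℕtoℚ (T * Y) ≡⟨ cong (_- ℕtoℚ (T * Y)) (sym (ℕtoℚ-* T X)) ⟩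
    ℕtoℚ (T * X) - ℕtoℚ (T * Y) ∎
    where
    open ≡-Reasoning
    expand : ∀ v t y → (v - 1ℚ) *ℚ (t *ℚ y) ≡ t *ℚ (v *ℚ y) - t *ℚ y
    expand = solve 3 (λ v t y → (v :- con 1ℚ) :* (t :* y) := t :* (v :* y) :- t :* y) refl
  below : ℚ.- (v - 1ℚ) *ℚ ℕtoℚ (T * Y) ≡ ℕtoℚ (T * Y) - ℕtoℚ (T * X)
  below = begin
    ℚ.- (v - 1ℚ) *ℚ ℕtoℚ (T * Y)           ≡⟨ negate (v - 1ℚ) (ℕtoℚ (T * Y)) ⟩
    ℚ.- ((v - 1ℚ) *ℚ ℕtoℚ (T * Y))         ≡⟨ cong ℚ.-_ above ⟩
    ℚ.- (ℕtoℚ (T * X) - ℕtoℚ (T * Y))      ≡⟨ negate′ (ℕtoℚ (T * X)) (ℕtoℚ (T * Y)) ⟩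
    ℕtoℚ (T * Y) - ℕtoℚ (T * X)            ∎
    where
    open ≡-Reasoning
    negate : ∀ p q → ℚ.- p *ℚ q ≡ ℚ.- (p *ℚ q)
    negate = solve 2 (λ p q → (:- p) :* q := :- (p :* q)) refl
    negate′ : ∀ p q → ℚ.- (p - q) ≡ q - p
    negate′ = solve 2 (λ p q → :- (p :- q) := q :- p) refl

ratio*ℕtoℚ[A*d^x] : ∀ d x P A → 0 < d → A ≢ 0 →
  ((ℕtoℚ P ÷₀ ℕtoℚ A) ÷₀ geom d (suc x)) *ℚ ℕtoℚ (A * d ^ x) ≡ ℕtoℚ (P * suc d ^ suc x)
ratio*ℕtoℚ[A*d^x] d x P A 0<d A≢0 = begin
  v *ℚ ℕtoℚ (A * d ^ x)
    ≡⟨ cong (v *ℚ_) (ℕtoℚ-* A (d ^ x)) ⟩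
  v *ℚ (ℕtoℚ A *ℚ ℕtoℚ (d ^ x))
    ≡⟨ cong (λ z → v *ℚ (ℕtoℚ A *ℚ z)) (sym (geom*[1+d]^[1+x] d x)) ⟩
  v *ℚ (ℕtoℚ A *ℚ (g *ℚ ℕtoℚ (suc d ^ suc x)))
    ≡⟨ regroup v (ℕtoℚ A) g _ ⟩
  ((v *ℚ g) *ℚ ℕtoℚ A) *ℚ ℕtoℚ (suc d ^ suc x)
    ≡⟨ cong (λ z → (z *ℚ ℕtoℚ A) *ℚ ℕtoℚ (suc d ^ suc x)) (÷₀-*-cancel p g g≢0) ⟩
  (p *ℚ ℕtoℚ A) *ℚ ℕtoℚ (suc d ^ suc x)
    ≡⟨ cong (_*ℚ ℕtoℚ (suc d ^ suc x))
            (÷₀-*-cancel (ℕtoℚ P) (ℕtoℚ A) (A≢0 ∘ ℕtoℚ≡0⇒≡0 A)) ⟩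
  ℕtoℚ P *ℚ ℕtoℚ (suc d ^ suc x)
    ≡⟨ sym (ℕtoℚ-* P (suc d ^ suc x)) ⟩
  ℕtoℚ (P * suc d ^ suc x) ∎
  where
  open ≡-Reasoning
  g p v : ℚ
  g = geom d (suc x)
  p = ℕtoℚ P ÷₀ ℕtoℚ A
  v = p ÷₀ g
  g≢0 : g ≢ 0ℚ
  g≢0 g≡0 = <⇒≢ (m^n>0 d {{>-nonZero 0<d}} x) (sym (ℕtoℚ≡0⇒≡0 (d ^ x) (begin
    ℕtoℚ (d ^ x)                 ≡⟨ sym (geom*[1+d]^[1+x] d x) ⟩
    g *ℚ ℕtoℚ (suc d ^ suc x)    ≡⟨ cong (_*ℚ ℕtoℚ (suc d ^ suc x)) g≡0 ⟩
    0ℚ *ℚ ℕtoℚ (suc d ^ suc x)   ≡⟨ ℚ.*-zeroˡ (ℕtoℚ (suc d ^ suc x)) ⟩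
    0ℚ                           ∎)))
  regroup : ∀ v a g b → v *ℚ (a *ℚ (g *ℚ b)) ≡ ((v *ℚ g) *ℚ a) *ℚ b
  regroup = solve 4 (λ v a g b → v :* (a :* (g :* b)) := ((v :* g) :* a) :* b) refl

probFirst/geom-close : ∀ a T m {x} → 4 * suc a * suc a * suc T + 2 ≤ m → x ≤ m →
  ∀ ε → 1ℚ ≤ℚ ε *ℚ ℕtoℚ T → ∣ (probFirst m (suc a) (suc x) ÷₀ geom (suc a) (suc x)) - 1ℚ ∣ <ℚ ε
probFirst/geom-close a T m {x} m≥ x≤m ε 1≤εT =
  subst (λ p → ∣ (p ÷₀ geom D (suc x)) - 1ℚ ∣ <ℚ ε) (sym probFirst≡)
    (∣v-1∣<ε ((ℕtoℚ P ÷₀ ℕtoℚ A) ÷₀ geom D (suc x)) ε T X Y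
             (ratio*ℕtoℚ[A*d^x] D x P A (s≤s z≤n) A≢0) 1≤εT
             (T*X<T*Z+Y T X Y Y V X≤W W≤Y+V TV<Y) (T*X<T*Z+Y T Y Y X V Y≤W W≤X+V TV<Y))
  where
  D P A X Y W V : ℕ
  D = suc a
  P = refinedEulerian m D x
  A = sumBelow (suc m) (refinedEulerian m D)
  X = P * suc D ^ suc x
  Y = A * D ^ x
  W = D ^ x * suc D ^ suc m
  V = D ^ x * slack m D
  X≤W : X ≤ W
  X≤W = proj₁ (refinedEulerian-scaled-bounds m a x≤m)
  W≤X+V : W ≤ X + V
  W≤X+V = proj₂ (refinedEulerian-scaled-bounds m a x≤m)
  Y≤W : Y ≤ W
  Y≤W = proj₁ (sumBelow-refinedEulerian-scaled-bounds m a x)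
  W≤Y+V : W ≤ Y + V
  W≤Y+V = proj₂ (sumBelow-refinedEulerian-scaled-bounds m a x)
  TV<Y : T * V < Y
  TV<Y = T*V<Y T Y V W≤Y+V (slack-small a T m x m≥)
  A≢0 : A ≢ 0
  A≢0 A≡0 = <⇒≢ (≤-<-trans z≤n TV<Y) (sym (cong (_* D ^ x) A≡0))
  probFirst≡ : probFirst m D (suc x) ≡ ℕtoℚ P ÷₀ ℕtoℚ A
  probFirst≡ =
    cong₂ (λ p q → ℕtoℚ p ÷₀ ℕtoℚ q) (countDesFirst≡refinedEulerian m D x≤m) (countDes≡sumBelow m D)

theorem8 : (d : ℕ) → 0 < d → (ε : ℚ) → 0ℚ <ℚ ε →
    Σ ℕ (λ N → (m k : ℕ) → N ≤ suc m → suc d ≤ suc m → 1 ≤ k → k ≤ suc m →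
    ∣ (probFirst m d k ÷₀ geom d k) - 1ℚ ∣ <ℚ ε)
theorem8 zero    ()  ε 0<ε
theorem8 (suc a) _   ε 0<ε = suc (4 * suc a * suc a * suc T + 2) , bound
  where
  T : ℕ
  T = ℚ.↧ₙ ε
  -- n ≥ d + 1 is implied by n ≥ N.
  bound : (m k : ℕ) → suc (4 * suc a * suc a * suc T + 2) ≤ suc m → suc (suc a) ≤ suc m →
          1 ≤ k → k ≤ suc m → ∣ (probFirst m (suc a) k ÷₀ geom (suc a) k) - 1ℚ ∣ <ℚ ε
  bound m (suc x) (s≤s m≥) _ _ (s≤s x≤m) =
    probFirst/geom-close a T m m≥ x≤m ε (1≤ε*↧ε ε {{ℚ.positive 0<ε}})
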